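{- Let $h\colon[n]\to[n]$ be a Hessenberg function and $w\in\mathfrak S_n$ a generator for $h$. If $w$ avoids the associated pattern $[1324]_h$, then $w$ is well-organized.
   Context: A Hessenberg function is a nondecreasing $h\colon[n]\to[n]$ with $h(i)\ge i$. Permutations are in one-line notation. A generator for $h$ is a $w$ with $w^{ -1}(w(i)+1)\le h(i)$ whenever $w(i)\le n-1$. $w$ contains the associated pattern $[1324]_h$ if $w(i)<w(k)<w(j)<w(\ell)$ for some $i<j<k<\ell\le h(j)$ with $k\le h(i)$, and avoids it otherwise. $Y(w)=\{w(i)\mid i\ge w^{ -1}(1),\ w(i)\le w(n)\}=\{y_0<\cdots<y_r\}$; $w$ is well-organized if $w^{ -1}(y_0)<w^{ -1}(y_1)<\cdots<w^{ -1}(y_r)=n$. -}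

module Defs where

open import Data.Nat as ℕ using (ℕ; suc)
open import Data.Fin using (Fin; zero; fromℕ<; toℕ; _≤_; _<_) renaming (fromℕ to lastF)
open import Data.Fin.Permutation using (Permutation′; _⟨$⟩ʳ_; _⟨$⟩ˡ_)
open import Data.Product using (Σ; ∃; ∃-syntax; _×_)
open import Relation.Nullary using (¬_)
open import Relation.Binary.PropositionalEquality using (_≡_)

-- Convention: [n] = {1,…,n} is modelled by Fin n (0-indexed: Fin element k stands for k+1).
-- A permutation w ∈ S_n is a Permutation′ n; w(i) = w ⟨$⟩ʳ i, w⁻¹(a) = w ⟨$⟩ˡ a.

record Hessenberg (n : ℕ) : Set where
  field
    fun  : Fin n → Fin n
    mono : ∀ i j → i ≤ j → fun i ≤ fun j
    ext  : ∀ i → i ≤ fun i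
open Hessenberg public

IsGenerator : ∀ {n} → Hessenberg n → Permutation′ n → Set
IsGenerator {n} h w =
  ∀ i → (p : suc (toℕ (w ⟨$⟩ʳ i)) ℕ.< n) → (w ⟨$⟩ˡ fromℕ< p) ≤ fun h i

Contains1324 : ∀ {n} → Hessenberg n → Permutation′ n → Set
Contains1324 {n} h w =
  ∃[ i ] ∃[ j ] ∃[ k ] ∃[ l ]
    (i < j × j < k × k < l × l ≤ fun h j × k ≤ fun h i ×
     (w ⟨$⟩ʳ i) < (w ⟨$⟩ʳ k) × (w ⟨$⟩ʳ k) < (w ⟨$⟩ʳ j) × (w ⟨$⟩ʳ j) < (w ⟨$⟩ʳ l))

Avoids1324 : ∀ {n} → Hessenberg n → Permutation′ n → Set
Avoids1324 h w = ¬ Contains1324 h w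

-- Y(w) = { w(i) | i ≥ w⁻¹(1), w(i) ≤ w(n) }  (here n ≥ 1, positions Fin (suc m)).
-- The value 1 is `zero`, position n is `lastF m`.
InY : ∀ {m} → Permutation′ (suc m) → Fin (suc m) → Set
InY {m} w y = ∃[ i ] (y ≡ w ⟨$⟩ʳ i × (w ⟨$⟩ˡ zero) ≤ i × (w ⟨$⟩ʳ i) ≤ (w ⟨$⟩ʳ lastF m))

-- Well-organized: writing Y(w) = {y₀ < ⋯ < y_r}, w⁻¹(y₀) < ⋯ < w⁻¹(y_r) = n.
-- I.e. w⁻¹ is strictly increasing on Y(w), and the largest element y_r of Y(w)
-- sits at position n.
WellOrganized : ∀ {m} → Permutation′ (suc m) → Set
WellOrganized {m} w =
  (∀ y y' → InY w y → InY w y' → y < y' → (w ⟨$⟩ˡ y) < (w ⟨$⟩ˡ y'))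
  × (∃[ yr ] (InY w yr × (∀ y → InY w y → y ≤ yr) × (w ⟨$⟩ˡ yr) ≡ lastF m))

-- The key observation: if w(a) < w(c) with a < b ≤ c, some pair of consecutive
-- values s, s+1 in [w(a), w(c)] has s placed before b and s+1 at or after b, and the generator
-- property puts the position of s+1 within h of the position of s.  Applied to an ordinary
-- occurrence i<j<k<l of 1324 across j, this either exhibits [1324]_h at once or replaces i, k by
-- an occurrence with k ≤ h(i); applied once more across k it exhibits [1324]_h.  So w avoids
-- 1324 outright, and then w is well-organized: two elements of Y(w) placed out of order,
-- together with the positions of the value 1 and of n, would form a 1324.

module Submission where

open import Defs
open import Data.Nat using (ℕ; suc)
open import Data.Fin.Permutation using (Permutation′)

open import Data.Nat as ℕ using (z≤n; s≤s⁻¹)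
open import Data.Nat.Properties
  using (≤-refl; ≤-reflexive; ≤-trans; <-trans; <⇒≤; ≤-<-trans; <-≤-trans; ≮⇒≥; ≰⇒>;
         n<1+n; m<n⇒m<1+n; m≤n⇒m<n∨m≡n)
open import Data.Fin using (Fin; zero; toℕ; fromℕ<; _≤_; _<_) renaming (fromℕ to lastF)
open import Data.Fin.Properties
  using (<-cmp; <⇒≢; ≤∧≢⇒<; ≤fromℕ; toℕ-fromℕ<; toℕ-injective; toℕ<n; any?; _<?_; _≤?_)
open import Data.Fin.Permutation using (_⟨$⟩ʳ_; _⟨$⟩ˡ_; inverseˡ; inverseʳ)
open import Data.Product using (∃₂; ∃-syntax; _×_; _,_)
open import Data.Sum using (_⊎_; inj₁; inj₂)
open import Data.Empty using (⊥-elim)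
open import Function using (_∘_)
open import Relation.Nullary using (¬_; Dec; yes; no)
open import Relation.Nullary.Decidable using (_×-dec_)
open import Relation.Unary using (Pred; Decidable)
open import Relation.Binary using (Tri; tri<; tri≈; tri>)
open import Relation.Binary.PropositionalEquality
  using (_≡_; _≢_; refl; sym; trans; cong; subst; subst₂; ≢-sym)

crossing : ∀ {p} {P : Pred ℕ p} → Decidable P → ∀ {a b} → a ℕ.< b → P a → ¬ P b →
           ∃[ s ] (a ℕ.≤ s × s ℕ.< b × P s × ¬ P (suc s))
crossing P? {b = suc b} a<1+b Pa ¬P1+b with P? b
... | yes Pb = b , s≤s⁻¹ a<1+b , n<1+n b , Pb , ¬P1+b
... | no ¬Pb with m≤n⇒m<n∨m≡n (s≤s⁻¹ a<1+b)
...   | inj₂ refl = ⊥-elim (¬Pb Pa)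
...   | inj₁ a<b with crossing P? a<b Pa ¬Pb
...     | s , a≤s , s<b , Ps , ¬P1+s = s , a≤s , m<n⇒m<1+n s<b , Ps , ¬P1+s

Pattern1324 : ∀ {n} → Permutation′ n → Fin n → Fin n → Fin n → Fin n → Set
Pattern1324 w i j k l =
  i < j × j < k × k < l ×
  (w ⟨$⟩ʳ i) < (w ⟨$⟩ʳ k) × (w ⟨$⟩ʳ k) < (w ⟨$⟩ʳ j) × (w ⟨$⟩ʳ j) < (w ⟨$⟩ʳ l)

Free1324 : ∀ {n} → Permutation′ n → Set
Free1324 w = ∀ {i j k l} → ¬ Pattern1324 w i j k l

module _ {n} (w : Permutation′ n) where

  ʳ-injective : ∀ {x y} → w ⟨$⟩ʳ x ≡ w ⟨$⟩ʳ y → x ≡ y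
  ʳ-injective e = trans (sym (inverseˡ w)) (trans (cong (w ⟨$⟩ˡ_) e) (inverseˡ w))

  <ʳ⇒≢ : ∀ {x y} → (w ⟨$⟩ʳ x) < (w ⟨$⟩ʳ y) → x ≢ y
  <ʳ⇒≢ wx<wy = <⇒≢ wx<wy ∘ cong (w ⟨$⟩ʳ_)

module _ {n} (h : Hessenberg n) (w : Permutation′ n) (gen : IsGenerator h w) where

  -- In the construction w(y) = w(x) + 1, which is what yields y ≤ h(x).
  record AscentAcross (a b c : Fin n) : Set where
    field
      x y   : Fin n
      x<b   : x < b
      b≤y   : b ≤ y
      wa≤wx : (w ⟨$⟩ʳ a) ≤ (w ⟨$⟩ʳ x)
      wx<wy : (w ⟨$⟩ʳ x) < (w ⟨$⟩ʳ y)
      wy≤wc : (w ⟨$⟩ʳ y) ≤ (w ⟨$⟩ʳ c)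
      y≤hx  : y ≤ fun h x

  PlacedBefore : Fin n → ℕ → Set
  PlacedBefore b v = ∃[ x ] (toℕ (w ⟨$⟩ʳ x) ≡ v × x < b)

  placedBefore? : ∀ b → Decidable (PlacedBefore b)
  placedBefore? b v = any? λ x → (toℕ (w ⟨$⟩ʳ x) ℕ.≟ v) ×-dec (x <? b)

  notPlacedBefore : ∀ {b c} → b ≤ c → ¬ PlacedBefore b (toℕ (w ⟨$⟩ʳ c))
  notPlacedBefore b≤c (x , wx≡wc , x<b) =
    <⇒≢ (<-≤-trans x<b b≤c) (ʳ-injective w (toℕ-injective wx≡wc))

  ascentAcross : ∀ {a b c} → a < b → b ≤ c → (w ⟨$⟩ʳ a) < (w ⟨$⟩ʳ c) → AscentAcross a b c
  ascentAcross {a} {b} {c} a<b b≤c wa<wc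
    with crossing (placedBefore? b) wa<wc (a , refl , a<b) (notPlacedBefore b≤c)
  ... | .(toℕ (w ⟨$⟩ʳ x)) , wa≤wx , wx<wc , (x , refl , x<b) , next-notBefore = record
    { x = x ; y = y ; x<b = x<b ; b≤y = b≤y ; wa≤wx = wa≤wx
    ; wx<wy = ≤-reflexive (sym wy≡1+wx)
    ; wy≤wc = subst (ℕ._≤ toℕ (w ⟨$⟩ʳ c)) (sym wy≡1+wx) wx<wc
    ; y≤hx = gen x 1+wx<n }
    where
    1+wx<n : suc (toℕ (w ⟨$⟩ʳ x)) ℕ.< n
    1+wx<n = ≤-<-trans wx<wc (toℕ<n _)
    y : Fin n
    y = w ⟨$⟩ˡ fromℕ< 1+wx<n
    wy≡1+wx : toℕ (w ⟨$⟩ʳ y) ≡ suc (toℕ (w ⟨$⟩ʳ x))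
    wy≡1+wx = trans (cong toℕ (inverseʳ w)) (toℕ-fromℕ< 1+wx<n)
    b≤y : b ≤ y
    b≤y = ≮⇒≥ λ y<b → next-notBefore (y , wy≡1+wx , y<b)

  pattern⇒contains⊎bounded : ∀ {i j k l} → Pattern1324 w i j k l →
    Contains1324 h w ⊎ ∃₂ λ i′ k′ → Pattern1324 w i′ j k′ l × k′ ≤ fun h i′
  pattern⇒contains⊎bounded {i} {j} {k} {l} (i<j , j<k , k<l , wi<wk , wk<wj , wj<wl) =
    compare-y-l (<-cmp y l)
    where
    open AscentAcross (ascentAcross i<j (<⇒≤ j<k) wi<wk)
    wy<wj : (w ⟨$⟩ʳ y) < (w ⟨$⟩ʳ j)
    wy<wj = ≤-<-trans wy≤wc wk<wj
    compare-y-l : Tri (y < l) (y ≡ l) (l < y) →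
      Contains1324 h w ⊎ ∃₂ λ i′ k′ → Pattern1324 w i′ j k′ l × k′ ≤ fun h i′
    compare-y-l (tri< y<l _ _) = inj₂ (x , y , (x<b , j<y , y<l , wx<wy , wy<wj , wj<wl) , y≤hx)
      where
      j<y : j < y
      j<y = ≤∧≢⇒< b≤y (≢-sym (<ʳ⇒≢ w wy<wj))
    compare-y-l (tri≈ _ y≡l _) = ⊥-elim (<ʳ⇒≢ w (<-trans wy<wj wj<wl) y≡l)
    compare-y-l (tri> _ _ l<y) = inj₁
      (x , j , k , l , x<b , j<k , k<l ,
       ≤-trans (<⇒≤ l<y) (≤-trans y≤hx (mono h x j (<⇒≤ x<b))) ,
       ≤-trans (<⇒≤ (<-trans k<l l<y)) y≤hx ,
       <-≤-trans wx<wy wy≤wc , wk<wj , wj<wl)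

  bounded-pattern⇒contains : ∀ {i j k l} → Pattern1324 w i j k l → k ≤ fun h i → Contains1324 h w
  bounded-pattern⇒contains {i} {j} {k} {l} (i<j , j<k , k<l , wi<wk , wk<wj , wj<wl) k≤hi =
    compare-j-x (j ≤? x)
    where
    open AscentAcross (ascentAcross j<k (<⇒≤ k<l) wj<wl)
    k<y : k < y
    k<y = ≤∧≢⇒< b≤y (<ʳ⇒≢ w (<-trans (<-≤-trans wk<wj wa≤wx) wx<wy))
    compare-j-x : Dec (j ≤ x) → Contains1324 h w
    compare-j-x (yes j≤x) =
      i , x , k , y , <-≤-trans i<j j≤x , x<b , k<y , y≤hx , k≤hi ,
      wi<wk , <-≤-trans wk<wj wa≤wx , wx<wy
    compare-j-x (no j≰x) =
      i , j , k , y , i<j , j<k , k<y , ≤-trans y≤hx (mono h x j (<⇒≤ (≰⇒> j≰x))) , k≤hi ,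
      wi<wk , wk<wj , ≤-<-trans wa≤wx wx<wy

  avoids⇒free : Avoids1324 h w → Free1324 w
  avoids⇒free avoids occurrence with pattern⇒contains⊎bounded occurrence
  ... | inj₁ contained = avoids contained
  ... | inj₂ (_ , _ , occurrence′ , k′≤hi′) = avoids (bounded-pattern⇒contains occurrence′ k′≤hi′)

module _ {m} (w : Permutation′ (suc m)) (free : Free1324 w) where

  private
    first last : Fin (suc m)
    first = w ⟨$⟩ˡ zero
    last = lastF m

  positions-increase : ∀ {i i′} → first ≤ i′ → (w ⟨$⟩ʳ i) < (w ⟨$⟩ʳ i′) →
    (w ⟨$⟩ʳ i′) ≤ (w ⟨$⟩ʳ last) → i < i′
  positions-increase {i} {i′} first≤i′ wi<wi′ wi′≤wlast with <-cmp i i′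
  ... | tri< i<i′ _ _ = i<i′
  ... | tri≈ _ i≡i′ _ = ⊥-elim (<ʳ⇒≢ w wi<wi′ i≡i′)
  ... | tri> _ _ i′<i = ⊥-elim (free (first<i′ , i′<i , i<last , wfirst<wi , wi<wi′ , wi′<wlast))
    where
    wfirst≡0 : w ⟨$⟩ʳ first ≡ zero
    wfirst≡0 = inverseʳ w
    first<i′ : first < i′
    first<i′ = ≤∧≢⇒< first≤i′
      (<ʳ⇒≢ w (subst (_< (w ⟨$⟩ʳ i′)) (sym wfirst≡0) (≤-<-trans z≤n wi<wi′)))
    wfirst<wi : (w ⟨$⟩ʳ first) < (w ⟨$⟩ʳ i)
    wfirst<wi = ≤∧≢⇒< (subst (_≤ (w ⟨$⟩ʳ i)) (sym wfirst≡0) z≤n)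
                      (<⇒≢ (<-trans first<i′ i′<i) ∘ ʳ-injective w)
    i<last : i < last
    i<last = ≤∧≢⇒< (≤fromℕ i) (<ʳ⇒≢ w (<-≤-trans wi<wi′ wi′≤wlast))
    wi′<wlast : (w ⟨$⟩ʳ i′) < (w ⟨$⟩ʳ last)
    wi′<wlast = ≤∧≢⇒< wi′≤wlast (<⇒≢ (<-≤-trans i′<i (≤fromℕ i)) ∘ ʳ-injective w)

  free⇒wellOrganized : WellOrganized w
  free⇒wellOrganized = increasing , w ⟨$⟩ʳ last , last∈Y , ≤last , inverseˡ w
    where
    increasing : ∀ y y′ → InY w y → InY w y′ → y < y′ → (w ⟨$⟩ˡ y) < (w ⟨$⟩ˡ y′)
    increasing _ _ (i , refl , _ , _) (i′ , refl , first≤i′ , wi′≤wlast) wi<wi′ =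
      subst₂ _<_ (sym (inverseˡ w)) (sym (inverseˡ w)) (positions-increase first≤i′ wi<wi′ wi′≤wlast)
    last∈Y : InY w (w ⟨$⟩ʳ last)
    last∈Y = last , refl , ≤fromℕ first , ≤-refl
    ≤last : ∀ y → InY w y → y ≤ (w ⟨$⟩ʳ last)
    ≤last _ (_ , refl , _ , wi≤wlast) = wi≤wlast

lemma4p4 : (m : ℕ) (h : Hessenberg (suc m)) (w : Permutation′ (suc m)) →
    IsGenerator h w → Avoids1324 h w → WellOrganized w
lemma4p4 m h w gen avoids = free⇒wellOrganized w (avoids⇒free h w gen avoids)
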